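{- Let $n \ge 1$ and let $k$ and $\ell$ be positive integers. Among all pairs $(T,v)$ with $T \in \mathcal{T}_n$ and $v$ a vertex of $T$, there are one-to-one correspondences between the following four sets: (i) pairs $(T,v)$ with $v$ a first-child of degree $k$ at level $\ell$ in $T$; (ii) pairs $(T,v)$ with $v$ a non-first-child of degree $k$ at level $\ell-1$ in $T$; (iii) pairs $(T,v)$ with $v$ a leaf of $T$ having exactly $k-1$ elder siblings, at level $\ell$; (iv) pairs $(T,v)$ with $v$ a non-leaf of outdegree $k$ at level $\ell-1$ in $T$. Moreover, the cardinality of each of these sets is $$\frac{k+2\ell-2}{2n-k}\binom{2n-k}{n+\ell-1}.$$
   Context: $\mathcal{T}_n$ denotes the set of rooted ordered (plane) trees with $n$ edges. In such a tree, $v$ is a child of $u$ (and $u$ the parent of $v$) if $v$ is adjacent to $u$ and farther from the root; the root is not a child of any vertex. Vertices with the same parent are siblings; siblings are linearly ordered left to right, and the siblings to the left of $v$ are its elder siblings. The first-child is the leftmost among a set of siblings; a non-first-child is any vertex that is not a first-child (in particular the root is a non-first-child). A leaf is a vertex with no children. The degree of a vertex is the number of edges incident to it; its outdegree is its number of children. The level of a vertex is its distance (number of edges) from the root. -}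

module Defs where

open import Data.Nat using (ℕ; zero; suc; _+_; _*_; _∸_)
open import Data.Bool using (Bool; true; false)
open import Data.Maybe using (Maybe; just; nothing)
open import Data.List using (List; []; _∷_; length; lookup)
open import Data.Fin using (Fin; toℕ)
open import Data.Product using (Σ; Σ-syntax; _×_)
open import Relation.Binary.PropositionalEquality using (_≡_)

data Tree : Set where
  node : List Tree → Tree

mutual
  edges : Tree → ℕ
  edges (node ts) = edgesL ts

  edgesL : List Tree → ℕ
  edgesL []       = 0
  edgesL (t ∷ ts) = suc (edges t) + edgesL ts

children : Tree → List Tree
children (node ts) = ts

-- Vertices of a tree, as paths from the root:
-- 'here' is the root; 'child i v' is vertex v in the subtree of the i-th child.
data Vertex : Tree → Set where
  here  : {t : Tree} → Vertex t
  child : {ts : List Tree} (i : Fin (length ts)) → Vertex (lookup ts i) → Vertex (node ts)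

subtree : {t : Tree} → Vertex t → Tree
subtree {t} here  = t
subtree (child i v) = subtree v

outdeg : {t : Tree} → Vertex t → ℕ
outdeg v = length (children (subtree v))

isRoot : {t : Tree} → Vertex t → Bool
isRoot here        = true
isRoot (child _ _) = false

degree : {t : Tree} → Vertex t → ℕ
degree {t} here      = outdeg {t} here
degree v@(child _ _) = suc (outdeg v)

level : {t : Tree} → Vertex t → ℕ
level here        = 0
level (child _ v) = suc (level v)

-- index (0-based position among its siblings) of a vertex; nothing for the root
siblingIndex : {t : Tree} → Vertex t → Maybe ℕ
siblingIndex here = nothing
siblingIndex (child i v) with siblingIndex v
... | nothing = just (toℕ i)
... | just j  = just j

isFirstChild : {t : Tree} → Vertex t → Bool
isFirstChild v with siblingIndex v
... | just zero = true
... | _         = false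

elderSiblings : {t : Tree} → Vertex t → ℕ
elderSiblings v with siblingIndex v
... | just j  = j
... | nothing = 0

Pairs : ℕ → ({t : Tree} → Vertex t → Set) → Set
Pairs n P = Σ[ T ∈ Tree ] (edges T ≡ n × Σ[ v ∈ Vertex T ] P v)

SetI : ℕ → ℕ → ℕ → Set
SetI n k ℓ = Pairs n (λ v → isFirstChild v ≡ true × degree v ≡ k × level v ≡ ℓ)

-- (ii) non-first-child (root included) of degree k at level ℓ - 1
SetII : ℕ → ℕ → ℕ → Set
SetII n k ℓ = Pairs n (λ v → isFirstChild v ≡ false × degree v ≡ k × level v ≡ ℓ ∸ 1)

SetIII : ℕ → ℕ → ℕ → Set
SetIII n k ℓ = Pairs n (λ v → outdeg v ≡ 0 × elderSiblings v ≡ k ∸ 1 × level v ≡ ℓ)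

-- (iv) non-leaf of outdegree k at level ℓ - 1 (non-leaf is automatic as k ≥ 1)
SetIV : ℕ → ℕ → ℕ → Set
SetIV n k ℓ = Pairs n (λ v → outdeg v ≡ k × level v ≡ ℓ ∸ 1)

-- A plane tree with a marked vertex v is the same as a zipper: the subtree at v together with,
-- for each edge on the path from v up to the root, the elder and younger siblings of its lower end.
-- Rewriting the lowest frame turns each of the sets (i)-(iii) bijectively into set (iv), seen as
-- zippers with ℓ - 1 frames whose marked vertex has k children: the parent of a first child v gets
-- a new first child carrying the younger siblings of v, followed by the children of v; a non-first
-- child adopts its nearest elder sibling as its first child; the parent of a leaf gets a new first
-- child carrying the younger siblings of the leaf, followed by its elder siblings.
-- Replacing every frame (es , ys) by the two trees node es and node ys, such a zipper in a tree
-- with n edges becomes a list of 2(ℓ - 1) + k trees with n - (ℓ - 1) - k edges, and lists of m trees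
-- with N edges are counted by the ballot numbers m / (2N + m) · C(2N + m, N).

module Submission where

open import Defs
open import Data.Nat using (ℕ; zero; suc; _+_; _*_; _∸_; _≤_; _<_; z≤n; s≤s; _≤?_; _≡ᵇ_)
open import Data.Nat.Properties
open import Data.Nat.Combinatorics
  using (_C_; nCk≡nC[n∸k]; k>n⇒nCk≡0; nC1≡n; nCk+nC[k+1]≡[n+1]C[k+1])
open import Data.Nat.ListAction using (sum)
open import Data.Nat.Tactic.RingSolver using (solve-∀)
open import Data.Bool using (Bool; true; false)
import Data.Bool as Bool
open import Data.Fin using (Fin; toℕ; zero; suc)
import Data.Fin.Properties as Fin
open import Data.List using (List; []; _∷_; length; lookup; _++_; null; map)
open import Data.List.Properties using (++-identityʳ)
open import Data.Maybe using (just; nothing)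
open import Data.Product using (Σ; Σ-syntax; _×_; _,_; proj₁; proj₂)
open import Data.Product.Function.Dependent.Propositional using (Σ-↔)
open import Data.Sum using (_⊎_; inj₁; inj₂)
open import Data.Sum.Function.Propositional using (_⊎-cong_)
open import Data.Empty using (⊥-elim)
open import Function.Bundles using (_↔_; _⤖_; mk↔ₛ′)
open import Function.Properties.Inverse using (↔-refl; ↔-trans; ↔-sym; ↔⇒⤖)
open import Relation.Nullary using (¬_; yes; no)
open import Relation.Nullary.Irrelevant using (Irrelevant)
open import Axiom.UniquenessOfIdentityProofs using (module Decidable⇒UIP)
open import Relation.Binary.PropositionalEquality
open ≡-Reasoning

pascal : ∀ n k → suc n C suc k ≡ n C k + n C suc k
pascal n k = sym (nCk+nC[k+1]≡[n+1]C[k+1] n k)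

-- n C⁻ k is n C (k − 1), except that n C⁻ 0 = 0: then Pascal's rule holds for every k.
_C⁻_ : ℕ → ℕ → ℕ
n C⁻ zero  = 0
n C⁻ suc k = n C k

pascal⁻ : ∀ n k → suc n C k ≡ n C⁻ k + n C k
pascal⁻ n zero    = refl
pascal⁻ n (suc k) = pascal n k

[1+n]*nCk≡[1+k]*[1+n]C[1+k] : ∀ n k → suc n * (n C k) ≡ suc k * (suc n C suc k)
[1+n]*nCk≡[1+k]*[1+n]C[1+k] zero    zero    = refl
[1+n]*nCk≡[1+k]*[1+n]C[1+k] zero    (suc k) =
  sym (trans (cong (suc (suc k) *_) (k>n⇒nCk≡0 {1} {suc (suc k)} (s≤s (s≤s z≤n)))) (*-zeroʳ (suc (suc k))))
[1+n]*nCk≡[1+k]*[1+n]C[1+k] (suc n) zero    =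
  trans (*-identityʳ (suc (suc n))) (sym (trans (+-identityʳ _) (nC1≡n (suc (suc n)))))
[1+n]*nCk≡[1+k]*[1+n]C[1+k] (suc n) (suc k) = begin
  suc (suc n) * (suc n C suc k)                ≡⟨ cong (suc (suc n) *_) (pascal n k) ⟩
  suc (suc n) * (x + y)                        ≡⟨ expand n x y ⟩
  suc n * x + suc n * y + (x + y)              ≡⟨ cong₂ (λ a b → a + b + (x + y)) ih₁ ih₂ ⟩
  suc k * u + suc (suc k) * v + (x + y)        ≡⟨ cong (suc k * u + suc (suc k) * v +_) (sym (pascal n k)) ⟩
  suc k * u + suc (suc k) * v + u              ≡⟨ collect k u v ⟩
  suc (suc k) * (u + v)                        ≡⟨ cong (suc (suc k) *_) (sym (pascal (suc n) (suc k))) ⟩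
  suc (suc k) * (suc (suc n) C suc (suc k))    ∎
  where
  x = n C k
  y = n C suc k
  u = suc n C suc k
  v = suc n C suc (suc k)
  ih₁ : suc n * x ≡ suc k * u
  ih₁ = [1+n]*nCk≡[1+k]*[1+n]C[1+k] n k
  ih₂ : suc n * y ≡ suc (suc k) * v
  ih₂ = [1+n]*nCk≡[1+k]*[1+n]C[1+k] n (suc k)
  expand : ∀ n x y → suc (suc n) * (x + y) ≡ suc n * x + suc n * y + (x + y)
  expand = solve-∀
  collect : ∀ k u v → suc k * u + suc (suc k) * v + u ≡ suc (suc k) * (u + v)
  collect = solve-∀

[1+n]*nC⁻k≡k*[1+n]Ck : ∀ n k → suc n * (n C⁻ k) ≡ k * (suc n C k)
[1+n]*nC⁻k≡k*[1+n]Ck n zero    = *-zeroʳ (suc n)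
[1+n]*nC⁻k≡k*[1+n]Ck n (suc k) = [1+n]*nCk≡[1+k]*[1+n]C[1+k] n k

[1+n]*nCk+k*[1+n]Ck≡[1+n]*[1+n]Ck : ∀ n k → suc n * (n C k) + k * (suc n C k) ≡ suc n * (suc n C k)
[1+n]*nCk+k*[1+n]Ck≡[1+n]*[1+n]Ck n k = begin
  suc n * (n C k) + k * (suc n C k)     ≡⟨ cong (suc n * (n C k) +_) (sym ([1+n]*nC⁻k≡k*[1+n]Ck n k)) ⟩
  suc n * (n C k) + suc n * (n C⁻ k)    ≡⟨ sym (*-distribˡ-+ (suc n) (n C k) (n C⁻ k)) ⟩
  suc n * (n C k + n C⁻ k)              ≡⟨ cong (suc n *_) (+-comm (n C k) (n C⁻ k)) ⟩
  suc n * (n C⁻ k + n C k)              ≡⟨ cong (suc n *_) (sym (pascal⁻ n k)) ⟩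
  suc n * (suc n C k)                   ∎

m+n≡o⇒oCm≡oCn : ∀ m n {o} → m + n ≡ o → o C m ≡ o C n
m+n≡o⇒oCm≡oCn m n refl = trans (nCk≡nC[n∸k] (m≤m+n m n)) (cong ((m + n) C_) (m+n∸m≡n m n))

-- Ballot numbers

-- The number of lists of m plane trees with N edges in total: either the first tree is a
-- single vertex, or it splits into its first subtree and the tree of its remaining subtrees.
forestCount : ℕ → ℕ → ℕ
forestCount zero    zero    = 1
forestCount (suc N) zero    = 0
forestCount zero    (suc m) = forestCount zero m
forestCount (suc N) (suc m) = forestCount (suc N) m + forestCount N (suc (suc m))

forestCount-zero : ∀ m → forestCount 0 m ≡ 1
forestCount-zero zero    = refl
forestCount-zero (suc m) = forestCount-zero m

forestCount+C⁻≡C : ∀ N M {a} → N + N + M ≡ a → forestCount N (suc M) + a C⁻ N ≡ a C N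
forestCount+C⁻≡C zero M refl = trans (+-identityʳ _) (forestCount-zero (suc M))
forestCount+C⁻≡C (suc N) zero refl = begin
  F + suc b C N                 ≡⟨ cong (F +_) (pascal⁻ b N) ⟩
  F + (b C⁻ N + b C N)          ≡⟨ sym (+-assoc F (b C⁻ N) (b C N)) ⟩
  F + b C⁻ N + b C N            ≡⟨ cong (_+ b C N) (forestCount+C⁻≡C N 1 (shift N)) ⟩
  b C N + b C N                 ≡⟨ cong (b C N +_) (m+n≡o⇒oCm≡oCn N (suc N) (sym (+-identityʳ _))) ⟩
  b C N + b C suc N             ≡⟨ sym (pascal b N) ⟩
  suc b C suc N                 ∎
  where
  b = N + suc N + 0
  F = forestCount N 2
  shift : ∀ N → N + N + 1 ≡ N + suc N + 0
  shift = solve-∀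
forestCount+C⁻≡C (suc N) (suc M) refl = begin
  X + Y + suc b C N             ≡⟨ cong (X + Y +_) (pascal⁻ b N) ⟩
  X + Y + (b C⁻ N + b C N)      ≡⟨ regroup X Y (b C⁻ N) (b C N) ⟩
  (X + b C N) + (Y + b C⁻ N)    ≡⟨ cong₂ _+_ (forestCount+C⁻≡C (suc N) M (sym (+-suc (N + suc N) M)))
                                             (forestCount+C⁻≡C N (suc (suc M)) (shift N M)) ⟩
  b C suc N + b C N             ≡⟨ +-comm (b C suc N) (b C N) ⟩
  b C N + b C suc N             ≡⟨ sym (pascal b N) ⟩
  suc b C suc N                 ∎
  where
  b = N + suc N + suc M
  X = forestCount (suc N) (suc M)
  Y = forestCount N (suc (suc (suc M)))
  regroup : ∀ x y u v → x + y + (u + v) ≡ (x + v) + (y + u)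
  regroup = solve-∀
  shift : ∀ N M → N + N + suc (suc M) ≡ N + suc N + suc M
  shift = solve-∀

forestCount-ballot : ∀ N M → forestCount N (suc M) * suc (N + N + M) ≡ suc M * (suc (N + N + M) C N)
-- Both sides are increased by (N + N) * c, so that no subtraction occurs.
forestCount-ballot N M = +-cancelʳ-≡ _ _ _ (begin
  F * suc a + (N + N) * c                     ≡⟨ cong (F * suc a +_) (*-distribʳ-+ c N N) ⟩
  F * suc a + (N * c + N * c)                 ≡⟨ cong (λ z → F * suc a + (z + N * c)) (sym absorb) ⟩
  F * suc a + (suc a * (a C⁻ N) + N * c)      ≡⟨ regroup F (a C⁻ N) (N * c) a ⟩
  suc a * (F + a C⁻ N) + N * c                ≡⟨ cong (λ z → suc a * z + N * c) (forestCount+C⁻≡C N M refl) ⟩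
  suc a * (a C N) + N * c                     ≡⟨ [1+n]*nCk+k*[1+n]Ck≡[1+n]*[1+n]Ck a N ⟩
  suc a * c                                   ≡⟨ split N M c ⟩
  suc M * c + (N + N) * c                     ∎)
  where
  a = N + N + M
  c = suc a C N
  F = forestCount N (suc M)
  absorb : suc a * (a C⁻ N) ≡ N * c
  absorb = [1+n]*nC⁻k≡k*[1+n]Ck a N
  regroup : ∀ f x y a → f * suc a + (suc a * x + y) ≡ suc a * (f + x) + y
  regroup = solve-∀
  split : ∀ N M c → suc (N + N + M) * c ≡ suc M * c + (N + N) * c
  split = solve-∀

×-irrelevant : ∀ {A B : Set} → Irrelevant A → Irrelevant B → Irrelevant (A × B)
×-irrelevant irrA irrB (a , b) (a′ , b′) = cong₂ _,_ (irrA a a′) (irrB b b′)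

Σ-≡-by-proj₁ : ∀ {A : Set} {P : A → Set} → (∀ {a} → Irrelevant (P a)) →
               {x y : Σ A P} → proj₁ x ≡ proj₁ y → x ≡ y
Σ-≡-by-proj₁ irr {a , p} {.a , q} refl = cong (a ,_) (irr p q)

Σ-irrelevant-↔ : ∀ {A B : Set} {P : A → Set} {Q : B → Set} →
                 (∀ {a} → Irrelevant (P a)) → (∀ {b} → Irrelevant (Q b)) →
                 (f : Σ A P → Σ B Q) (g : Σ B Q → Σ A P) →
                 (∀ y → proj₁ (f (g y)) ≡ proj₁ y) → (∀ x → proj₁ (g (f x)) ≡ proj₁ x) →
                 Σ A P ↔ Σ B Q
Σ-irrelevant-↔ irrP irrQ f g fg gf =
  mk↔ₛ′ f g (λ y → Σ-≡-by-proj₁ irrQ (fg y)) (λ x → Σ-≡-by-proj₁ irrP (gf x))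

Pointed : Set
Pointed = Σ Tree Vertex

PointedForest : Set
PointedForest = Σ[ ts ∈ List Tree ] Σ[ i ∈ Fin (length ts) ] Vertex (lookup ts i)

underRoot : PointedForest → Pointed
underRoot (ts , i , v) = node ts , child i v

siblingIndex-underRoot-nothing : ∀ q → siblingIndex (proj₂ (proj₂ q)) ≡ nothing →
                                 siblingIndex (proj₂ (underRoot q)) ≡ just (toℕ (proj₁ (proj₂ q)))
siblingIndex-underRoot-nothing (ts , i , v) eq rewrite eq = refl

siblingIndex-underRoot-just : ∀ q {j} → siblingIndex (proj₂ (proj₂ q)) ≡ just j →
                              siblingIndex (proj₂ (underRoot q)) ≡ just j
siblingIndex-underRoot-just (ts , i , v) eq rewrite eq = refl

degree-nonroot : ∀ {t} (v : Vertex t) {j} → siblingIndex v ≡ just j → degree v ≡ suc (outdeg v)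
degree-nonroot (child i v) _ = refl

isFirstChild-index : ∀ {t} (v : Vertex t) {j} → siblingIndex v ≡ just j → isFirstChild v ≡ (j ≡ᵇ 0)
isFirstChild-index v {zero}  eq rewrite eq = refl
isFirstChild-index v {suc j} eq rewrite eq = refl

elderSiblings-index : ∀ {t} (v : Vertex t) {j} → siblingIndex v ≡ just j → elderSiblings v ≡ j
elderSiblings-index v eq rewrite eq = refl

-- Zippers

-- The siblings of a vertex: its elder siblings, nearest first, and its younger siblings.
Frame : Set
Frame = List Tree × List Tree

-- The frames on the path from a vertex up to the root, nearest first, and the subtree at the vertex.
Zipper : Set
Zipper = List Frame × Tree

prependElders : List Tree → PointedForest → PointedForest
prependElders []       p            = p
prependElders (e ∷ es) (ts , i , v) = prependElders es (e ∷ ts , suc i , v)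

up : Frame → Pointed → Pointed
up (es , ys) (t , v) = underRoot (prependElders es (t ∷ ys , zero , v))

climb : List Frame → Pointed → Pointed
climb []       p = p
climb (f ∷ fs) p = climb fs (up f p)

fromZipper : Zipper → Pointed
fromZipper (fs , s) = climb fs (s , here)

zipperTree : Zipper → Tree
zipperTree z = proj₁ (fromZipper z)

zipperVertex : (z : Zipper) → Vertex (zipperTree z)
zipperVertex z = proj₂ (fromZipper z)

mutual
  descend : List Frame → (t : Tree) → Vertex t → Zipper
  descend fs t         here        = fs , t
  descend fs (node ts) (child i v) = descendSiblings fs [] ts i v

  descendSiblings : List Frame → List Tree → (ts : List Tree) (i : Fin (length ts)) →
                    Vertex (lookup ts i) → Zipper
  descendSiblings fs es (t ∷ ts) zero    v = descend ((es , ts) ∷ fs) t v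
  descendSiblings fs es (t ∷ ts) (suc i) v = descendSiblings fs (t ∷ es) ts i v

toZipper : Pointed → Zipper
toZipper (t , v) = descend [] t v

descendSiblings-prependElders : ∀ fs es es′ ts i v →
  let (ts′ , i′ , v′) = prependElders es′ (ts , i , v)
  in descendSiblings fs es ts′ i′ v′ ≡ descendSiblings fs (es′ ++ es) ts i v
descendSiblings-prependElders fs es []        ts i v = refl
descendSiblings-prependElders fs es (e ∷ es′) ts i v = descendSiblings-prependElders fs es es′ (e ∷ ts) (suc i) v

descend-climb : ∀ fs gs (p : Pointed) →
  let (t , v) = climb gs p in descend fs t v ≡ descend (gs ++ fs) (proj₁ p) (proj₂ p)
descend-climb fs []              p       = refl
descend-climb fs ((es , ys) ∷ gs) (t , v) =
  trans (descend-climb fs gs (up (es , ys) (t , v)))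
  (trans (descendSiblings-prependElders (gs ++ fs) [] es (t ∷ ys) zero v)
         (cong (λ es → descend ((es , ys) ∷ gs ++ fs) t v) (++-identityʳ es)))

toZipper-fromZipper : ∀ z → toZipper (fromZipper z) ≡ z
toZipper-fromZipper (fs , s) = trans (descend-climb [] fs (s , here)) (cong (_, s) (++-identityʳ fs))

mutual
  fromZipper-descend : ∀ fs t (v : Vertex t) → fromZipper (descend fs t v) ≡ climb fs (t , v)
  fromZipper-descend fs t         here        = refl
  fromZipper-descend fs (node ts) (child i v) = fromZipper-descendSiblings fs [] ts i v

  fromZipper-descendSiblings : ∀ fs es ts i v →
    fromZipper (descendSiblings fs es ts i v) ≡ climb fs (underRoot (prependElders es (ts , i , v)))
  fromZipper-descendSiblings fs es (t ∷ ts) zero    v = fromZipper-descend ((es , ts) ∷ fs) t v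
  fromZipper-descendSiblings fs es (t ∷ ts) (suc i) v = fromZipper-descendSiblings fs (t ∷ es) ts i v

Pointed↔Zipper : Pointed ↔ Zipper
Pointed↔Zipper = mk↔ₛ′ toZipper fromZipper toZipper-fromZipper (λ (t , v) → fromZipper-descend [] t v)

frameEdges : Frame → ℕ
frameEdges (es , ys) = suc (edgesL es + edgesL ys)

framesEdges : List Frame → ℕ
framesEdges []       = 0
framesEdges (f ∷ fs) = frameEdges f + framesEdges fs

prependElders-vertex : ∀ {A : Set} (attr : ∀ {t} → Vertex t → A) es ts i v →
                       attr (proj₂ (proj₂ (prependElders es (ts , i , v)))) ≡ attr v
prependElders-vertex attr []       ts i v = refl
prependElders-vertex attr (e ∷ es) ts i v = prependElders-vertex attr es (e ∷ ts) (suc i) v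

prependElders-index : ∀ es ts i v → toℕ (proj₁ (proj₂ (prependElders es (ts , i , v)))) ≡ length es + toℕ i
prependElders-index []       ts i v = refl
prependElders-index (e ∷ es) ts i v =
  trans (prependElders-index es (e ∷ ts) (suc i) v) (+-suc (length es) (toℕ i))

prependElders-edges : ∀ es ts i v → edgesL (proj₁ (prependElders es (ts , i , v))) ≡ edgesL es + edgesL ts
prependElders-edges []       ts i v = refl
prependElders-edges (e ∷ es) ts i v =
  trans (prependElders-edges es (e ∷ ts) (suc i) v) (move (edgesL es) (edges e) (edgesL ts))
  where
  move : ∀ a b c → a + (suc b + c) ≡ suc b + a + c
  move = solve-∀

climb-edges : ∀ fs p → edges (proj₁ (climb fs p)) ≡ framesEdges fs + edges (proj₁ p)
climb-edges []               p       = refl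
climb-edges ((es , ys) ∷ fs) (t , v) = begin
  edges (proj₁ (climb fs (up (es , ys) (t , v))))   ≡⟨ climb-edges fs (up (es , ys) (t , v)) ⟩
  framesEdges fs + edgesL (proj₁ q)                 ≡⟨ cong (framesEdges fs +_) (prependElders-edges es (t ∷ ys) zero v) ⟩
  framesEdges fs + (edgesL es + edgesL (t ∷ ys))    ≡⟨ move (framesEdges fs) (edgesL es) (edgesL ys) (edges t) ⟩
  frameEdges (es , ys) + framesEdges fs + edges t   ∎
  where
  q = prependElders es (t ∷ ys , zero , v)
  move : ∀ f a y t → f + (a + (suc t + y)) ≡ suc (a + y) + f + t
  move = solve-∀

climb-level : ∀ fs p → level (proj₂ (climb fs p)) ≡ length fs + level (proj₂ p)
climb-level []               p       = refl
climb-level ((es , ys) ∷ fs) (t , v) =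
  trans (climb-level fs (up (es , ys) (t , v)))
  (trans (cong (λ l → length fs + suc l) (prependElders-vertex level es (t ∷ ys) zero v))
         (+-suc (length fs) (level v)))

climb-subtree : ∀ fs p → subtree (proj₂ (climb fs p)) ≡ subtree (proj₂ p)
climb-subtree []               p       = refl
climb-subtree ((es , ys) ∷ fs) (t , v) =
  trans (climb-subtree fs (up (es , ys) (t , v))) (prependElders-vertex subtree es (t ∷ ys) zero v)

climb-siblingIndex : ∀ fs p {j} → siblingIndex (proj₂ p) ≡ just j → siblingIndex (proj₂ (climb fs p)) ≡ just j
climb-siblingIndex []               p       eq = eq
climb-siblingIndex ((es , ys) ∷ fs) (t , v) eq = climb-siblingIndex fs (up (es , ys) (t , v))
  (siblingIndex-underRoot-just (prependElders es (t ∷ ys , zero , v))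
    (trans (prependElders-vertex siblingIndex es (t ∷ ys) zero v) eq))

edges-zipperTree : ∀ fs s → edges (zipperTree (fs , s)) ≡ framesEdges fs + edges s
edges-zipperTree fs s = climb-edges fs (s , here)

level-zipperVertex : ∀ fs s → level (zipperVertex (fs , s)) ≡ length fs
level-zipperVertex fs s = trans (climb-level fs (s , here)) (+-identityʳ (length fs))

outdeg-zipperVertex : ∀ fs s → outdeg (zipperVertex (fs , s)) ≡ length (children s)
outdeg-zipperVertex fs s = cong (λ t → length (children t)) (climb-subtree fs (s , here))

siblingIndex-zipperVertex : ∀ es ys fs s → siblingIndex (zipperVertex ((es , ys) ∷ fs , s)) ≡ just (length es)
siblingIndex-zipperVertex es ys fs s = climb-siblingIndex fs (up (es , ys) (s , here))
  (trans (siblingIndex-underRoot-nothing (prependElders es (s ∷ ys , zero , here))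
           (prependElders-vertex siblingIndex es (s ∷ ys) zero here))
         (cong just (trans (prependElders-index es (s ∷ ys) zero here) (+-identityʳ (length es)))))

degree-zipperVertex : ∀ f fs s → degree (zipperVertex (f ∷ fs , s)) ≡ suc (length (children s))
degree-zipperVertex (es , ys) fs s =
  trans (degree-nonroot (zipperVertex ((es , ys) ∷ fs , s)) (siblingIndex-zipperVertex es ys fs s))
        (cong suc (outdeg-zipperVertex ((es , ys) ∷ fs) s))

isFirstChild-zipperVertex : ∀ es ys fs s → isFirstChild (zipperVertex ((es , ys) ∷ fs , s)) ≡ null es
isFirstChild-zipperVertex []       ys fs s =
  isFirstChild-index (zipperVertex (([] , ys) ∷ fs , s)) (siblingIndex-zipperVertex [] ys fs s)
isFirstChild-zipperVertex (e ∷ es) ys fs s =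
  isFirstChild-index (zipperVertex ((e ∷ es , ys) ∷ fs , s)) (siblingIndex-zipperVertex (e ∷ es) ys fs s)

elderSiblings-zipperVertex : ∀ es ys fs s → elderSiblings (zipperVertex ((es , ys) ∷ fs , s)) ≡ length es
elderSiblings-zipperVertex es ys fs s =
  elderSiblings-index (zipperVertex ((es , ys) ∷ fs , s)) (siblingIndex-zipperVertex es ys fs s)

-- Forests

¬⇒↔Fin0 : ∀ {A : Set} → ¬ A → A ↔ Fin 0
¬⇒↔Fin0 ¬a = mk↔ₛ′ (λ a → ⊥-elim (¬a a)) (λ ()) (λ ()) (λ a → ⊥-elim (¬a a))

IsForest : ℕ → ℕ → List Tree → Set
IsForest m N ts = length ts ≡ m × sum (map edges ts) ≡ N

Forest : ℕ → ℕ → Set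
Forest m N = Σ (List Tree) (IsForest m N)

Forest-≡ : ∀ {m N} {x y : Forest m N} → proj₁ x ≡ proj₁ y → x ≡ y
Forest-≡ = Σ-≡-by-proj₁ (×-irrelevant ≡-irrelevant ≡-irrelevant)

Forest00↔Fin1 : Forest 0 0 ↔ Fin 1
Forest00↔Fin1 = mk↔ₛ′ (λ _ → zero) (λ _ → [] , refl , refl) (λ { zero → refl })
  (λ { ([] , _) → Forest-≡ refl })

¬Forest0[1+N] : ∀ {N} → ¬ Forest 0 (suc N)
¬Forest0[1+N] ([] , _ , ())

Forest[1+m]0↔Forestm0 : ∀ m → Forest (suc m) 0 ↔ Forest m 0
Forest[1+m]0↔Forestm0 m = mk↔ₛ′ dropLeaf (λ (ts , l , e) → node [] ∷ ts , cong suc l , e)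
  (λ _ → Forest-≡ refl)
  (λ { (node [] ∷ ts , _) → Forest-≡ refl })
  where
  dropLeaf : Forest (suc m) 0 → Forest m 0
  dropLeaf (node [] ∷ ts , l , e) = ts , suc-injective l , e

Forest[1+m][1+N]↔ : ∀ m N → Forest (suc m) (suc N) ↔ (Forest m (suc N) ⊎ Forest (suc (suc m)) N)
Forest[1+m][1+N]↔ m N = mk↔ₛ′ split join
  (λ { (inj₁ _) → cong inj₁ (Forest-≡ refl)
     ; (inj₂ (_ ∷ node _ ∷ _ , _)) → cong inj₂ (Forest-≡ refl) })
  (λ { (node [] ∷ _ , _) → Forest-≡ refl
     ; (node (_ ∷ _) ∷ _ , _) → Forest-≡ refl })
  where
  split : Forest (suc m) (suc N) → Forest m (suc N) ⊎ Forest (suc (suc m)) N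
  split (node []       ∷ ts , l , e) = inj₁ (ts , suc-injective l , e)
  split (node (c ∷ cs) ∷ ts , l , e) =
    inj₂ (c ∷ node cs ∷ ts , cong suc l , suc-injective (trans (cong suc (sym (+-assoc (edges c) _ _))) e))
  join : Forest m (suc N) ⊎ Forest (suc (suc m)) N → Forest (suc m) (suc N)
  join (inj₁ (ts , l , e))               = node [] ∷ ts , cong suc l , e
  join (inj₂ (c ∷ node cs ∷ ts , l , e)) =
    node (c ∷ cs) ∷ ts , suc-injective l , cong suc (trans (+-assoc (edges c) _ _) e)

Forest↔Fin : ∀ N m → Forest m N ↔ Fin (forestCount N m)
Forest↔Fin zero    zero    = Forest00↔Fin1
Forest↔Fin (suc N) zero    = ¬⇒↔Fin0 ¬Forest0[1+N]
Forest↔Fin zero    (suc m) = ↔-trans (Forest[1+m]0↔Forestm0 m) (Forest↔Fin zero m)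
Forest↔Fin (suc N) (suc m) = ↔-trans (Forest[1+m][1+N]↔ m N)
  (↔-trans (Forest↔Fin (suc N) m ⊎-cong Forest↔Fin N (suc (suc m)))
           (↔-sym (Fin.+↔⊎ {forestCount (suc N) m})))

-- Spines

-- The zipper (fs , node cs) of a vertex at level d with k children, in a tree with n edges.
IsSpine : ℕ → ℕ → ℕ → List Frame × List Tree → Set
IsSpine d k n (fs , cs) = length fs ≡ d × length cs ≡ k × framesEdges fs + edgesL cs ≡ n

Spine : ℕ → ℕ → ℕ → Set
Spine d k n = Σ (List Frame × List Tree) (IsSpine d k n)

IsSpine-irrelevant : ∀ {d k n} p → Irrelevant (IsSpine d k n p)
IsSpine-irrelevant (fs , cs) = ×-irrelevant ≡-irrelevant (×-irrelevant ≡-irrelevant ≡-irrelevant)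

Spine-≡ : ∀ {d k n} {x y : Spine d k n} → proj₁ x ≡ proj₁ y → x ≡ y
Spine-≡ = Σ-≡-by-proj₁ (λ {p} → IsSpine-irrelevant p)

flatten : List Frame → List Tree
flatten []               = []
flatten ((es , ys) ∷ fs) = node es ∷ node ys ∷ flatten fs

unflatten : ℕ → List Tree → List Frame × List Tree
unflatten zero    ts               = [] , ts
unflatten (suc d) (e ∷ y ∷ ts)     = let (fs , cs) = unflatten d ts in (children e , children y) ∷ fs , cs
unflatten (suc d) _                = [] , []

edgesL≡length+sum : ∀ ts → edgesL ts ≡ length ts + sum (map edges ts)
edgesL≡length+sum []       = refl
edgesL≡length+sum (t ∷ ts) = cong suc (trans (cong (edges t +_) (edgesL≡length+sum ts))
                                             (+-comm-middle (edges t) (length ts) _))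
  where
  +-comm-middle : ∀ a b c → a + (b + c) ≡ b + (a + c)
  +-comm-middle = solve-∀

spineEdges-flatten : ∀ fs cs → framesEdges fs + edgesL cs ≡ length fs + length cs + sum (map edges (flatten fs ++ cs))
spineEdges-flatten []               cs = edgesL≡length+sum cs
spineEdges-flatten ((es , ys) ∷ fs) cs = cong suc (begin
  edgesL es + edgesL ys + framesEdges fs + edgesL cs           ≡⟨ +-assoc (edgesL es + edgesL ys) _ _ ⟩
  edgesL es + edgesL ys + (framesEdges fs + edgesL cs)         ≡⟨ cong (edgesL es + edgesL ys +_) (spineEdges-flatten fs cs) ⟩
  edgesL es + edgesL ys + (length fs + length cs + r)          ≡⟨ regroup (edgesL es) (edgesL ys) (length fs) (length cs) r ⟩
  length fs + length cs + (edgesL es + (edgesL ys + r))        ∎)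
  where
  r = sum (map edges (flatten fs ++ cs))
  regroup : ∀ a b f c r → a + b + (f + c + r) ≡ f + c + (a + (b + r))
  regroup = solve-∀

length-flatten : ∀ fs cs → length (flatten fs ++ cs) ≡ length fs + length fs + length cs
length-flatten []               cs = refl
length-flatten ((es , ys) ∷ fs) cs = cong suc (trans (cong suc (length-flatten fs cs))
  (cong (_+ length cs) (sym (+-suc (length fs) (length fs)))))

unflatten-flatten : ∀ fs cs → unflatten (length fs) (flatten fs ++ cs) ≡ (fs , cs)
unflatten-flatten []               cs = refl
unflatten-flatten ((es , ys) ∷ fs) cs rewrite unflatten-flatten fs cs = refl

flatten-unflatten : ∀ d k ts → length ts ≡ d + d + k →
  let (fs , cs) = unflatten d ts in flatten fs ++ cs ≡ ts × length fs ≡ d × length cs ≡ k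
flatten-unflatten zero    k ts           l = refl , refl , l
flatten-unflatten (suc d) k (e ∷ [])     l with () ← trans (suc-injective l) (cong (_+ k) (+-suc d d))
flatten-unflatten (suc d) k (node es ∷ node ys ∷ ts) l
  with flatten-unflatten d k ts (suc-injective (trans (suc-injective l) (cong (_+ k) (+-suc d d))))
... | ts≡ , ld , lk = cong (λ ts → node es ∷ node ys ∷ ts) ts≡ , cong suc ld , lk

IsSpine⇒edges : ∀ {d k n} fs cs → IsSpine d k n (fs , cs) → n ≡ d + k + sum (map edges (flatten fs ++ cs))
IsSpine⇒edges fs cs (refl , refl , refl) = spineEdges-flatten fs cs

Spine↔Forest : ∀ d k n N → n ≡ d + k + N → Spine d k n ↔ Forest (d + d + k) N
Spine↔Forest d k n N n≡ = mk↔ₛ′ to from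
  (λ (ts , l , _) → Forest-≡ (proj₁ (flatten-unflatten d k ts l)))
  (λ ((fs , cs) , ld , _) → Spine-≡ (trans (cong (λ d → unflatten d (flatten fs ++ cs)) (sym ld))
                                           (unflatten-flatten fs cs)))
  where
  to : Spine d k n → Forest (d + d + k) N
  to ((fs , cs) , spine@(ld , lk , _)) = flatten fs ++ cs ,
    trans (length-flatten fs cs) (cong₂ (λ d k → d + d + k) ld lk) ,
    +-cancelˡ-≡ (d + k) _ _ (trans (sym (IsSpine⇒edges fs cs spine)) n≡)
  from : Forest (d + d + k) N → Spine d k n
  from (ts , l , e) =
    let (ts≡ , ld , lk) = flatten-unflatten d k ts l
        (fs , cs)       = unflatten d ts
        r               = sum (map edges (flatten fs ++ cs))
    in  (fs , cs) , ld , lk , (begin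
      framesEdges fs + edgesL cs   ≡⟨ spineEdges-flatten fs cs ⟩
      length fs + length cs + r    ≡⟨ cong₂ (λ d k → d + k + r) ld lk ⟩
      d + k + r                    ≡⟨ cong (λ ts → d + k + sum (map edges ts)) ts≡ ⟩
      d + k + sum (map edges ts)   ≡⟨ cong (d + k +_) e ⟩
      d + k + N                    ≡⟨ sym n≡ ⟩
      n                            ∎)

¬Spine : ∀ {d k n} → n < d + k → ¬ Spine d k n
¬Spine {d} {k} n<d+k ((fs , cs) , spine) =
  <⇒≱ n<d+k (subst (d + k ≤_) (sym (IsSpine⇒edges fs cs spine)) (m≤m+n (d + k) _))

ZipperPairs : ℕ → ({t : Tree} → Vertex t → Set) → Set
ZipperPairs n P = Σ[ z ∈ Zipper ] (edges (zipperTree z) ≡ n × P (zipperVertex z))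

Pairs↔ZipperPairs : ∀ n (P : {t : Tree} → Vertex t → Set) → Pairs n P ↔ ZipperPairs n P
Pairs↔ZipperPairs n P = ↔-trans reassociate (↔-sym (Σ-↔ (↔-sym Pointed↔Zipper) ↔-refl))
  where
  reassociate : Pairs n P ↔ Σ Pointed (λ (t , v) → edges t ≡ n × P v)
  reassociate = mk↔ₛ′ (λ (t , e , v , p) → (t , v) , e , p) (λ ((t , v) , e , p) → t , e , v , p)
                      (λ _ → refl) (λ _ → refl)

Pairs↔Spine : ∀ {n d k} (P : {t : Tree} → Vertex t → Set) → (∀ {t} {v : Vertex t} → Irrelevant (P v)) →
              (f : ZipperPairs n P → Spine d k n) (g : Spine d k n → ZipperPairs n P) →
              (∀ y → proj₁ (f (g y)) ≡ proj₁ y) → (∀ x → proj₁ (g (f x)) ≡ proj₁ x) →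
              Pairs n P ↔ Spine d k n
Pairs↔Spine {n} P irr f g fg gf = ↔-trans (Pairs↔ZipperPairs n P)
  (Σ-irrelevant-↔ (×-irrelevant ≡-irrelevant irr) (λ {p} → IsSpine-irrelevant p) f g fg gf)

Bool-≡-irrelevant : {a b : Bool} → Irrelevant (a ≡ b)
Bool-≡-irrelevant = Decidable⇒UIP.≡-irrelevant Bool._≟_

ConditionI : ℕ → ℕ → {t : Tree} → Vertex t → Set
ConditionI k ℓ v = isFirstChild v ≡ true × degree v ≡ k × level v ≡ ℓ

ConditionII : ℕ → ℕ → {t : Tree} → Vertex t → Set
ConditionII k ℓ v = isFirstChild v ≡ false × degree v ≡ k × level v ≡ ℓ ∸ 1

ConditionIII : ℕ → ℕ → {t : Tree} → Vertex t → Set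
ConditionIII k ℓ v = outdeg v ≡ 0 × elderSiblings v ≡ k ∸ 1 × level v ≡ ℓ

ConditionIV : ℕ → ℕ → {t : Tree} → Vertex t → Set
ConditionIV k ℓ v = outdeg v ≡ k × level v ≡ ℓ ∸ 1

SetI↔Spine : ∀ n k d → SetI n (suc k) (suc d) ↔ Spine d (suc k) n
SetI↔Spine n k d = Pairs↔Spine (ConditionI (suc k) (suc d))
  (×-irrelevant Bool-≡-irrelevant (×-irrelevant ≡-irrelevant ≡-irrelevant)) to from
  (λ { ((fs , node ys ∷ cs) , _) → refl })
  (λ { ((([] , ys) ∷ fs , node cs) , _) → refl
     ; (([] , _) , _ , _ , _ , ())
     ; (((e ∷ es , ys) ∷ fs , s) , _ , first , _) → ⊥-elim (elder-not-first e es ys fs s first) })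
  where
  elder-not-first : ∀ e es ys fs s → ¬ isFirstChild (zipperVertex ((e ∷ es , ys) ∷ fs , s)) ≡ true
  elder-not-first e es ys fs s first with () ← trans (sym first) (isFirstChild-zipperVertex (e ∷ es) ys fs s)
  shuffle : ∀ y f c → suc y + f + c ≡ f + (suc y + c)
  shuffle = solve-∀
  to : ZipperPairs n (ConditionI (suc k) (suc d)) → Spine d (suc k) n
  to (([] , s) , _ , _ , _ , ())
  to (((e ∷ es , ys) ∷ fs , s) , _ , first , _) = ⊥-elim (elder-not-first e es ys fs s first)
  to ((([] , ys) ∷ fs , node cs) , e , _ , deg , lvl) = (fs , node ys ∷ cs) ,
    suc-injective (trans (sym (level-zipperVertex (([] , ys) ∷ fs) (node cs))) lvl) ,
    trans (sym (degree-zipperVertex ([] , ys) fs (node cs))) deg ,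
    trans (sym (shuffle (edgesL ys) (framesEdges fs) (edgesL cs)))
          (trans (sym (edges-zipperTree (([] , ys) ∷ fs) (node cs))) e)
  from : Spine d (suc k) n → ZipperPairs n (ConditionI (suc k) (suc d))
  from ((fs , node ys ∷ cs) , ld , lk , e) = (([] , ys) ∷ fs , node cs) ,
    trans (edges-zipperTree (([] , ys) ∷ fs) (node cs))
          (trans (shuffle (edgesL ys) (framesEdges fs) (edgesL cs)) e) ,
    isFirstChild-zipperVertex [] ys fs (node cs) ,
    trans (degree-zipperVertex ([] , ys) fs (node cs)) lk ,
    trans (level-zipperVertex (([] , ys) ∷ fs) (node cs)) (cong suc ld)

SetII↔Spine : ∀ n k d → SetII n (suc k) (suc d) ↔ Spine d (suc k) n
SetII↔Spine n k d = Pairs↔Spine (ConditionII (suc k) (suc d))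
  (×-irrelevant Bool-≡-irrelevant (×-irrelevant ≡-irrelevant ≡-irrelevant)) to from
  (λ { (([] , cs) , _) → refl ; ((_ ∷ _ , _ ∷ _) , _) → refl })
  (λ { (([] , node cs) , _) → refl
     ; (((a ∷ es , ys) ∷ fs , node cs) , _) → refl
     ; ((([] , ys) ∷ fs , s) , _ , first , _) → ⊥-elim (eldest-first ys fs s first) })
  where
  eldest-first : ∀ ys fs s → ¬ isFirstChild (zipperVertex (([] , ys) ∷ fs , s)) ≡ false
  eldest-first ys fs s notFirst with () ← trans (sym notFirst) (isFirstChild-zipperVertex [] ys fs s)
  shuffle : ∀ a e y f c → suc (suc a + e + y) + f + c ≡ suc (e + y) + f + (suc a + c)
  shuffle = solve-∀
  to : ZipperPairs n (ConditionII (suc k) (suc d)) → Spine d (suc k) n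
  to (([] , node cs) , e , _ , deg , lvl) = ([] , cs) , lvl , deg , e
  to ((([] , ys) ∷ fs , s) , _ , first , _) = ⊥-elim (eldest-first ys fs s first)
  to (((a ∷ es , ys) ∷ fs , node cs) , e , _ , deg , lvl) = ((es , ys) ∷ fs , a ∷ cs) ,
    trans (sym (level-zipperVertex ((a ∷ es , ys) ∷ fs) (node cs))) lvl ,
    trans (sym (degree-zipperVertex (a ∷ es , ys) fs (node cs))) deg ,
    trans (sym (shuffle (edges a) (edgesL es) (edgesL ys) (framesEdges fs) (edgesL cs)))
          (trans (sym (edges-zipperTree ((a ∷ es , ys) ∷ fs) (node cs))) e)
  from : Spine d (suc k) n → ZipperPairs n (ConditionII (suc k) (suc d))
  from (([] , cs) , ld , lk , e) = ([] , node cs) , e , refl , lk , ld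
  from (((es , ys) ∷ fs , a ∷ cs) , ld , lk , e) = ((a ∷ es , ys) ∷ fs , node cs) ,
    trans (edges-zipperTree ((a ∷ es , ys) ∷ fs) (node cs))
          (trans (shuffle (edges a) (edgesL es) (edgesL ys) (framesEdges fs) (edgesL cs)) e) ,
    isFirstChild-zipperVertex (a ∷ es) ys fs (node cs) ,
    trans (degree-zipperVertex (a ∷ es , ys) fs (node cs)) lk ,
    trans (level-zipperVertex ((a ∷ es , ys) ∷ fs) (node cs)) ld

SetIII↔Spine : ∀ n k d → SetIII n (suc k) (suc d) ↔ Spine d (suc k) n
SetIII↔Spine n k d = Pairs↔Spine (ConditionIII (suc k) (suc d))
  (×-irrelevant ≡-irrelevant (×-irrelevant ≡-irrelevant ≡-irrelevant)) to from
  (λ { ((fs , node ys ∷ es) , _) → refl })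
  (λ { (((es , ys) ∷ fs , node []) , _) → refl
     ; (([] , _) , _ , _ , _ , ())
     ; ((f ∷ fs , node (c ∷ cs)) , _ , leaf , _) → ⊥-elim (nonleaf f fs c cs leaf) })
  where
  nonleaf : ∀ f fs c cs → ¬ outdeg (zipperVertex (f ∷ fs , node (c ∷ cs))) ≡ 0
  nonleaf f fs c cs leaf with () ← trans (sym (outdeg-zipperVertex (f ∷ fs) (node (c ∷ cs)))) leaf
  shuffle : ∀ e y f → suc (e + y) + f + 0 ≡ f + (suc y + e)
  shuffle = solve-∀
  to : ZipperPairs n (ConditionIII (suc k) (suc d)) → Spine d (suc k) n
  to (([] , s) , _ , _ , _ , ())
  to ((f ∷ fs , node (c ∷ cs)) , _ , leaf , _) = ⊥-elim (nonleaf f fs c cs leaf)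
  to (((es , ys) ∷ fs , node []) , e , _ , eld , lvl) = (fs , node ys ∷ es) ,
    suc-injective (trans (sym (level-zipperVertex ((es , ys) ∷ fs) (node []))) lvl) ,
    cong suc (trans (sym (elderSiblings-zipperVertex es ys fs (node []))) eld) ,
    trans (sym (shuffle (edgesL es) (edgesL ys) (framesEdges fs)))
          (trans (sym (edges-zipperTree ((es , ys) ∷ fs) (node []))) e)
  from : Spine d (suc k) n → ZipperPairs n (ConditionIII (suc k) (suc d))
  from ((fs , node ys ∷ es) , ld , lk , e) = ((es , ys) ∷ fs , node []) ,
    trans (edges-zipperTree ((es , ys) ∷ fs) (node []))
          (trans (shuffle (edgesL es) (edgesL ys) (framesEdges fs)) e) ,
    outdeg-zipperVertex ((es , ys) ∷ fs) (node []) ,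
    trans (elderSiblings-zipperVertex es ys fs (node [])) (suc-injective lk) ,
    trans (level-zipperVertex ((es , ys) ∷ fs) (node [])) (cong suc ld)

SetIV↔Spine : ∀ n k d → SetIV n k (suc d) ↔ Spine d k n
SetIV↔Spine n k d = Pairs↔Spine (ConditionIV k (suc d)) (×-irrelevant ≡-irrelevant ≡-irrelevant) to from
  (λ _ → refl) (λ { ((fs , node cs) , _) → refl })
  where
  to : ZipperPairs n (ConditionIV k (suc d)) → Spine d k n
  to ((fs , node cs) , e , out , lvl) = (fs , cs) ,
    trans (sym (level-zipperVertex fs (node cs))) lvl ,
    trans (sym (outdeg-zipperVertex fs (node cs))) out ,
    trans (sym (edges-zipperTree fs (node cs))) e
  from : Spine d k n → ZipperPairs n (ConditionIV k (suc d))
  from ((fs , cs) , ld , lk , e) = (fs , node cs) ,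
    trans (edges-zipperTree fs (node cs)) e ,
    trans (outdeg-zipperVertex fs (node cs)) lk ,
    trans (level-zipperVertex fs (node cs)) ld

-- Counting spines

spineCount : ℕ → ℕ → ℕ → ℕ
spineCount d k n with d + k ≤? n
... | yes _ = forestCount (n ∸ (d + k)) (d + d + k)
... | no  _ = 0

Spine↔Fin : ∀ d k n → Spine d k n ↔ Fin (spineCount d k n)
Spine↔Fin d k n with d + k ≤? n
... | yes d+k≤n = ↔-trans (Spine↔Forest d k n (n ∸ (d + k)) (sym (m+[n∸m]≡n d+k≤n)))
                          (Forest↔Fin (n ∸ (d + k)) (d + d + k))
... | no  d+k≰n = ¬⇒↔Fin0 (¬Spine (≰⇒> d+k≰n))

spineCount-ballot : ∀ d k N {n} → d + suc k + N ≡ n →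
  forestCount N (d + d + suc k) * (2 * n ∸ suc k) ≡ (suc k + 2 * d) * ((2 * n ∸ suc k) C (n + d))
spineCount-ballot d k N refl = begin
  forestCount N (d + d + suc k) * w       ≡⟨ cong₂ _*_ (cong (forestCount N) (+-suc (d + d) k)) width ⟩
  forestCount N (suc M) * suc (N + N + M) ≡⟨ forestCount-ballot N M ⟩
  suc M * (suc (N + N + M) C N)           ≡⟨ cong₂ _*_ (weight d k) (sym binomial) ⟩
  (suc k + 2 * d) * (w C a)               ∎
  where
  M = d + d + k
  a = d + suc k + N + d
  w = 2 * (d + suc k + N) ∸ suc k
  width : w ≡ suc (N + N + M)
  width = trans (cong (_∸ suc k) (split d k N)) (m+n∸n≡m (suc (N + N + M)) (suc k))
    where
    split : ∀ d k N → 2 * (d + suc k + N) ≡ suc (N + N + (d + d + k)) + suc k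
    split = solve-∀
  weight : ∀ d k → suc (d + d + k) ≡ suc k + 2 * d
  weight = solve-∀
  total : ∀ d k N → suc (N + N + (d + d + k)) ≡ d + suc k + N + d + N
  total = solve-∀
  binomial : w C a ≡ suc (N + N + M) C N
  binomial = trans (m+n≡o⇒oCm≡oCn a N (sym (trans width (total d k N)))) (cong (_C N) width)

spineCount-formula : ∀ d k n →
  spineCount d (suc k) (suc n) * (2 * suc n ∸ suc k) ≡ (suc k + 2 * d) * ((2 * suc n ∸ suc k) C (suc n + d))
spineCount-formula d k n with d + suc k ≤? suc n
... | yes d+k≤n = spineCount-ballot d k (suc n ∸ (d + suc k)) (m+[n∸m]≡n d+k≤n)
... | no  d+k≰n = sym (trans (cong ((suc k + 2 * d) *_) (k>n⇒nCk≡0 (m<n+o⇒m∸n<o (2 * suc n) (suc k) 2n<k+n+d)))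
                             (*-zeroʳ (suc k + 2 * d)))
  where
  2n<k+n+d : 2 * suc n < suc k + (suc n + d)
  2n<k+n+d = subst₂ _<_ (cong (suc n +_) (sym (+-identityʳ (suc n)))) (regroup (suc n) d k)
                        (+-monoʳ-< (suc n) (subst (suc n <_) (+-comm d (suc k)) (≰⇒> d+k≰n)))
    where
    regroup : ∀ n d k → n + (suc k + d) ≡ suc k + (n + d)
    regroup = solve-∀

theorem1p4 : (n k ℓ : ℕ) → 1 ≤ n → 1 ≤ k → 1 ≤ ℓ →
    (SetI n k ℓ ⤖ SetII n k ℓ) × (SetI n k ℓ ⤖ SetIII n k ℓ) × (SetI n k ℓ ⤖ SetIV n k ℓ)
    × (Σ[ N ∈ ℕ ] ((SetI n k ℓ ⤖ Fin N)
        × N * (2 * n ∸ k) ≡ (k + 2 * ℓ ∸ 2) * ((2 * n ∸ k) C (n + ℓ ∸ 1))))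
theorem1p4 (suc n) (suc k) (suc d) _ _ _ =
  ↔⇒⤖ (↔-trans I↔Spine (↔-sym (SetII↔Spine (suc n) k d))) ,
  ↔⇒⤖ (↔-trans I↔Spine (↔-sym (SetIII↔Spine (suc n) k d))) ,
  ↔⇒⤖ (↔-trans I↔Spine (↔-sym (SetIV↔Spine (suc n) (suc k) d))) ,
  spineCount d (suc k) (suc n) , ↔⇒⤖ (↔-trans I↔Spine (Spine↔Fin d (suc k) (suc n))) ,
  trans (spineCount-formula d k n)
        (cong₂ (λ w a → w * ((2 * suc n ∸ suc k) C a)) (sym (weight k d)) (cong (_∸ 1) (sym (+-suc (suc n) d))))
  where
  I↔Spine : SetI (suc n) (suc k) (suc d) ↔ Spine d (suc k) (suc n)
  I↔Spine = SetI↔Spine (suc n) k d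
  weight : ∀ k d → suc k + 2 * suc d ∸ 2 ≡ suc k + 2 * d
  weight k d = trans (cong (_∸ 2) (regroup k d)) (m+n∸n≡m (suc k + 2 * d) 2)
    where
    regroup : ∀ k d → suc k + 2 * suc d ≡ suc k + 2 * d + 2
    regroup = solve-∀
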